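{- Let $G=(V,E)$ be a connected graph with a fixed spanning tree $T$, let $u,u'$ be two vertices of $G$ and let $\alpha,\beta$ be two proper 3-colourings of $G$. Then there exists a constant $D$ such that for every $v\in V$, $h_{\alpha,u}(\beta,v)=h_{\alpha,u'}(\beta,v)+D$.
   Context: A proper 3-colouring is a map $c:V\to\{1,2,3\}$ with $c(x)\ne c(y)$ for all $xy\in E$. For an edge oriented from $x$ to $y$, its weight under $c$ is the value $w(c,\overrightarrow{xy})\in\{ -1,1\}$ with $w(c,\overrightarrow{xy})\equiv c(y)-c(x)\pmod 3$. The weight $w(c,\overrightarrow{P})$ of an oriented path is the sum of the weights of its edges. For vertices $u,v$, $\overrightarrow{P_{uv}}$ is the unique path from $u$ to $v$ in $T$, oriented from $u$ to $v$. For proper 3-colourings $\alpha,c$, the relative height is $h_{\alpha,u}(c,v)=w(c,\overrightarrow{P_{uv}})-w(\alpha,\overrightarrow{P_{uv}})$. -}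

module Defs where

open import Data.Nat using (ℕ; _+_; _∸_; _%_)
open import Data.Nat.Base using (_≡ᵇ_)
open import Data.Fin using (Fin; toℕ)
open import Data.Integer using (ℤ; +_; -_) renaming (_+_ to _+ℤ_; _-_ to _-ℤ_)
open import Data.List using (List; []; _∷_)
open import Data.List.Relation.Unary.Unique.Propositional using (Unique)
open import Data.Product using (Σ; ∃; _×_; _,_; proj₁)
open import Data.Bool using (if_then_else_)
open import Relation.Binary.PropositionalEquality using (_≡_; _≢_)
open import Relation.Nullary using (¬_)

record Graph (n : ℕ) : Set₁ where
  field
    Adj   : Fin n → Fin n → Set
    sym   : ∀ {x y} → Adj x y → Adj y x
    irrefl : ∀ {x} → ¬ Adj x x
open Graph public

data Walk {n : ℕ} (R : Fin n → Fin n → Set) : Fin n → Fin n → Set where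
  []  : ∀ {v} → Walk R v v
  _∷_ : ∀ {u w v} → R u w → Walk R w v → Walk R u v

vertices : ∀ {n} {R : Fin n → Fin n → Set} {u v : Fin n} → Walk R u v → List (Fin n)
vertices {u = u} []        = u ∷ []
vertices {u = u} (e ∷ p)   = u ∷ vertices p

IsPath : ∀ {n} {R : Fin n → Fin n → Set} {u v : Fin n} → Walk R u v → Set
IsPath p = Unique (vertices p)

Path : ∀ {n} (R : Fin n → Fin n → Set) → Fin n → Fin n → Set
Path R u v = Σ (Walk R u v) IsPath

Connected : ∀ {n} → Graph n → Set
Connected {n} G = ∀ (u v : Fin n) → Path (Adj G) u v

record SpanningTree {n : ℕ} (G : Graph n) : Set₁ where
  field
    tree      : Graph n
    subgraph  : ∀ {x y} → Adj tree x y → Adj G x y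
    path      : ∀ (u v : Fin n) → Path (Adj tree) u v
    path-uniq : ∀ (u v : Fin n) (p q : Path (Adj tree) u v) →
                vertices (proj₁ p) ≡ vertices (proj₁ q)
open SpanningTree public

-- 3-colourings with colours Fin 3 (standing for {1,2,3}).
Colouring : ℕ → Set
Colouring n = Fin n → Fin 3

Proper : ∀ {n} → Graph n → Colouring n → Set
Proper G c = ∀ {x y} → Adj G x y → c x ≢ c y

-- weight of the oriented edge x → y: the value in {-1,1} congruent to c(y) - c(x) mod 3
edgeWeight : ∀ {n} → Colouring n → Fin n → Fin n → ℤ
edgeWeight c x y =
  if ((toℕ (c y) + 3 ∸ toℕ (c x)) % 3) ≡ᵇ 1 then + 1 else - (+ 1)

walkWeight : ∀ {n} {R : Fin n → Fin n → Set} → Colouring n → {u v : Fin n} → Walk R u v → ℤ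
walkWeight c []                 = + 0
walkWeight c {u = u} (_∷_ {w = w} e p) = edgeWeight c u w +ℤ walkWeight c p

P : ∀ {n} {G : Graph n} → (T : SpanningTree G) → (u v : Fin n) → Walk (Adj (tree T)) u v
P T u v = proj₁ (path T u v)

height : ∀ {n} {G : Graph n} → SpanningTree G → (α : Colouring n) → (u : Fin n) →
         (c : Colouring n) → (v : Fin n) → ℤ
height T α u c v = walkWeight c (P T u v) -ℤ walkWeight α (P T u v)

-- Along a tree edge a–b the weight of the tree path to any v satisfies
-- w(c, P_av) = w(c, ab) + w(c, P_bv): either a ∉ P_bv and P_av is the edge
-- followed by P_bv, or a ∈ P_bv and P_bv is the edge b → a followed by P_av,
-- whose weight is −w(c, ab) since c is proper. Iterating along P_{u'u} gives
-- w(c, P_uv) = w(c, P_{u'v}) − w(c, P_{u'u}) for every proper c, and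
-- subtracting this identity for α from the one for β yields the constant
-- D = w(α, P_{u'u}) − w(β, P_{u'u}).
module Submission where

open import Defs hiding (sym)
open import Data.Nat using (ℕ)
open import Data.Fin using (Fin; zero; suc)
open import Data.Fin.Properties using (_≟_)
open import Data.Integer using (ℤ; 0ℤ; _+_; -_; _-_)
open import Data.Integer.Properties using (+-assoc; +-identityˡ; +-identityʳ)
open import Data.Integer.Tactic.RingSolver using (solve-∀)
open import Data.Product using (∃; _,_; proj₁; proj₂)
open import Data.List using (List; []; _∷_)
open import Data.List.Relation.Unary.All using ([]; _∷_)
open import Data.List.Relation.Unary.All.Properties using (¬Any⇒All¬; anti-mono)
open import Data.List.Relation.Unary.Any using (here; there)
open import Data.List.Relation.Unary.AllPairs using ([]; _∷_)
open import Data.List.Relation.Binary.Subset.Propositional using (_⊆_)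
open import Data.List.Membership.Propositional using (_∈_)
import Data.List.Membership.DecPropositional as DecMembership
open import Relation.Binary.PropositionalEquality
  using (_≡_; _≢_; refl; sym; trans; cong; module ≡-Reasoning)
open import Relation.Nullary using (yes; no)
open import Data.Empty using (⊥-elim)

module _ {n : ℕ} where
  open DecMembership (_≟_ {n}) using (_∈?_)

  -- path-uniq identifies tree paths only through their vertex lists, so
  -- weights are recomputed from those lists.
  listWeight : Colouring n → List (Fin n) → ℤ
  listWeight c (x ∷ y ∷ ys) = edgeWeight c x y + listWeight c (y ∷ ys)
  listWeight c _            = 0ℤ

  walkWeight≡listWeight : ∀ {R : Fin n → Fin n → Set} (c : Colouring n) {u v}
                          (p : Walk R u v) → walkWeight c p ≡ listWeight c (vertices p)
  walkWeight≡listWeight c []            = refl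
  walkWeight≡listWeight c (e ∷ [])      = refl
  walkWeight≡listWeight c (e ∷ e′ ∷ p) =
    cong (edgeWeight c _ _ +_) (walkWeight≡listWeight c (e′ ∷ p))

  edgeWeight-antisym : (c : Colouring n) {a b : Fin n} → c a ≢ c b →
                       edgeWeight c b a ≡ - edgeWeight c a b
  edgeWeight-antisym c {a} {b} ca≢cb with c a | c b
  ... | zero           | zero           = ⊥-elim (ca≢cb refl)
  ... | zero           | suc zero       = refl
  ... | zero           | suc (suc zero) = refl
  ... | suc zero       | zero           = refl
  ... | suc zero       | suc zero       = ⊥-elim (ca≢cb refl)
  ... | suc zero       | suc (suc zero) = refl
  ... | suc (suc zero) | zero           = refl
  ... | suc (suc zero) | suc zero       = refl
  ... | suc (suc zero) | suc (suc zero) = ⊥-elim (ca≢cb refl)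

  record PathSplit {R : Fin n → Fin n → Set} {b v : Fin n} (p : Walk R b v) (a : Fin n) : Set where
    field
      prefix        : Walk R b a
      suffix        : Walk R a v
      prefix-isPath : IsPath prefix
      suffix-isPath : IsPath suffix
      prefix-⊆      : vertices prefix ⊆ vertices p
      weight-split  : ∀ c → walkWeight c p ≡ walkWeight c prefix + walkWeight c suffix

  splitPath : ∀ {R : Fin n → Fin n → Set} {a b v} (p : Walk R b v) →
              IsPath p → a ∈ vertices p → PathSplit p a
  splitPath [] p-path (here refl) =
    record { prefix = []; suffix = []; prefix-isPath = [] ∷ []; suffix-isPath = p-path
           ; prefix-⊆ = λ { (here refl) → here refl }; weight-split = λ _ → refl }
  splitPath (e ∷ p) p-path (here refl) =
    record { prefix = []; suffix = e ∷ p; prefix-isPath = [] ∷ []; suffix-isPath = p-path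
           ; prefix-⊆ = λ { (here refl) → here refl }
           ; weight-split = λ c → sym (+-identityˡ _) }
  splitPath {b = b} (_∷_ {w = w} e p) (b∉p ∷ p-path) (there a∈p) =
    record { prefix = e ∷ prefix; suffix = suffix
           ; prefix-isPath = anti-mono prefix-⊆ b∉p ∷ prefix-isPath
           ; suffix-isPath = suffix-isPath
           ; prefix-⊆ = λ { (here refl) → here refl; (there x∈) → there (prefix-⊆ x∈) }
           ; weight-split = λ c → trans (cong (edgeWeight c b w +_) (weight-split c))
                                        (sym (+-assoc (edgeWeight c b w) (walkWeight c prefix) _)) }
    where open PathSplit (splitPath p p-path a∈p)

  module _ {G : Graph n} (T : SpanningTree G) (c : Colouring n) where

    pathWeight-unique : ∀ {a b} (p q : Path (Adj (tree T)) a b) →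
                        walkWeight c (proj₁ p) ≡ walkWeight c (proj₁ q)
    pathWeight-unique {a} {b} p q = begin
      walkWeight c (proj₁ p)              ≡⟨ walkWeight≡listWeight c (proj₁ p) ⟩
      listWeight c (vertices (proj₁ p))   ≡⟨ cong (listWeight c) (path-uniq T a b p q) ⟩
      listWeight c (vertices (proj₁ q))   ≡⟨ sym (walkWeight≡listWeight c (proj₁ q)) ⟩
      walkWeight c (proj₁ q)              ∎
      where open ≡-Reasoning

    module _ (proper : Proper G c) where

      weight-P-edge : ∀ {a b} → Adj (tree T) a b → ∀ v →
                      walkWeight c (P T a v) ≡ edgeWeight c a b + walkWeight c (P T b v)
      weight-P-edge {a} {b} e v with a ∈? vertices (P T b v)
      ... | no a∉P = pathWeight-unique (path T a v) (e ∷ P T b v , ¬Any⇒All¬ _ a∉P ∷ proj₂ (path T b v))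
      ... | yes a∈P = begin
        walkWeight c (P T a v)                         ≡⟨ pathWeight-unique (path T a v) (suffix , suffix-isPath) ⟩
        walkWeight c suffix                            ≡⟨ sym (x+[-x+z]≡z (edgeWeight c a b) (walkWeight c suffix)) ⟩
        edgeWeight c a b + (- edgeWeight c a b + walkWeight c suffix)
          ≡⟨ cong (λ w → edgeWeight c a b + (w + walkWeight c suffix)) (sym prefix-weight) ⟩
        edgeWeight c a b + (walkWeight c prefix + walkWeight c suffix)
          ≡⟨ cong (edgeWeight c a b +_) (sym (weight-split c)) ⟩
        edgeWeight c a b + walkWeight c (P T b v)      ∎
        where
        open ≡-Reasoning
        open PathSplit (splitPath (P T b v) (proj₂ (path T b v)) a∈P)

        x+[-x+z]≡z : ∀ x z → x + (- x + z) ≡ z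
        x+[-x+z]≡z = solve-∀

        b≢a : b ≢ a
        b≢a refl = irrefl (tree T) e

        prefix-weight : walkWeight c prefix ≡ - edgeWeight c a b
        prefix-weight = begin
          walkWeight c prefix       ≡⟨ pathWeight-unique (prefix , prefix-isPath)
                                         (Graph.sym (tree T) e ∷ [] , (b≢a ∷ []) ∷ [] ∷ []) ⟩
          edgeWeight c b a + 0ℤ     ≡⟨ +-identityʳ _ ⟩
          edgeWeight c b a          ≡⟨ edgeWeight-antisym c (proper (subgraph T e)) ⟩
          - edgeWeight c a b        ∎

      weight-P-along : ∀ {x y} (q : Walk (Adj (tree T)) x y) → ∀ v →
                       walkWeight c (P T x v) ≡ walkWeight c q + walkWeight c (P T y v)
      weight-P-along []      v = sym (+-identityˡ _)
      weight-P-along {x} {y} (_∷_ {w = w} e q) v = begin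
        walkWeight c (P T x v)                                       ≡⟨ weight-P-edge e v ⟩
        edgeWeight c x w + walkWeight c (P T w v)                    ≡⟨ cong (edgeWeight c x w +_) (weight-P-along q v) ⟩
        edgeWeight c x w + (walkWeight c q + walkWeight c (P T y v)) ≡⟨ sym (+-assoc (edgeWeight c x w) _ _) ⟩
        walkWeight c (e ∷ q) + walkWeight c (P T y v)                ∎
        where open ≡-Reasoning

difference-shift : ∀ (b a b′ a′ bq aq : ℤ) → b′ ≡ bq + b → a′ ≡ aq + a →
                   b - a ≡ (b′ - a′) + (aq - bq)
difference-shift b a b′ a′ bq aq refl refl = ring b a bq aq
  where
  ring : ∀ b a bq aq → b - a ≡ ((bq + b) - (aq + a)) + (aq - bq)
  ring = solve-∀

lemma4 : ∀ (n : ℕ) (G : Graph n) → Connected G → (T : SpanningTree G) →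
    (u u' : Fin n) (α β : Colouring n) → Proper G α → Proper G β →
    ∃ λ (D : ℤ) → ∀ (v : Fin n) → height T α u β v ≡ height T α u' β v + D
lemma4 n G _ T u u' α β α-proper β-proper =
  walkWeight α (P T u' u) - walkWeight β (P T u' u) , λ v →
    difference-shift (walkWeight β (P T u v)) (walkWeight α (P T u v)) _ _
                     (walkWeight β (P T u' u)) (walkWeight α (P T u' u))
      (weight-P-along T β β-proper (P T u' u) v)
      (weight-P-along T α α-proper (P T u' u) v)
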